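{- Let $N,M,T$ be positive integers and $K>0$. Let $\mathcal{H}$ be a $2$-universal family of hash functions $[N]\to[M]$ and $H$ a uniformly random member of $\mathcal{H}$. Let $\mathbf{X}=(X_1,\dots,X_T)$ be a block $K$-source over $[N]^T$ independent of $H$, and let $(H,\mathbf{Y})=(H,H(X_1),\dots,H(X_T))$. Then $\mathrm{cp}(H)=1/|\mathcal{H}|$, and for every $i\in[T]$, $\mathrm{cp}(Y_i\mid H,Y_{<i})\le 1/M+1/K$, where $Y_{<i}=(Y_1,\dots,Y_{i-1})$.
   Context: $[n]=\{1,\dots,n\}$. A hash family is a multiset $\mathcal{H}$ of functions $[N]\to[M]$, and $H$ is obtained by choosing one of its $|\mathcal{H}|$ members uniformly at random. It is $2$-universal if for all distinct $x_1,x_2\in[N]$, $\Pr_H[H(x_1)=H(x_2)]\le1/M$. $\mathrm{cp}(X)=\sum_x\Pr[X=x]^2$; conditional collision probability $\mathrm{cp}(X\mid W)=\mathbb{E}_{w\leftarrow W}[\mathrm{cp}(X|_{W=w})]$. A sequence $(X_1,\dots,X_T)$ over $[N]^T$ is a block $K$-source if for every $i$ and every $x_{<i}$ in the support of $(X_1,\dots,X_{i-1})$, $\mathrm{cp}(X_i\mid X_{<i}=x_{<i})\le1/K$. -}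

module Defs where

open import Data.Nat as ℕ using (ℕ; zero; suc)
open import Data.Fin as Fin using (Fin; zero; suc; toℕ)
open import Data.Fin.Properties using () renaming (_≟_ to _≟ᶠ_)
open import Data.Vec as Vec using (Vec; []; _∷_; lookup)
open import Data.Vec.Properties using () renaming (≡-dec to ≡-decᵛ)
open import Data.List as List using (List; []; _∷_; allFin; cartesianProduct; concatMap)
open import Data.Product using (_×_; _,_)
open import Data.Product.Properties using () renaming (≡-dec to ≡-decˣ)
open import Data.Integer using (+_)
open import Data.Rational using (ℚ; 0ℚ; 1ℚ; _+_; _*_; _÷_; _/_; _≟_; ≢-nonZero; _≤_; _<_)
open import Relation.Binary.Definitions using (DecidableEquality)
open import Relation.Nullary using (yes; no; ¬_)
open import Relation.Nullary.Decidable using (⌊_⌋)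
open import Relation.Binary.PropositionalEquality using (_≡_)
open import Data.Bool using (Bool; true; if_then_else_) renaming (_≟_ to _≟ᵇ_)

Σℚ : List ℚ → ℚ
Σℚ = List.foldr _+_ 0ℚ

Σ[_]_ : {A : Set} → List A → (A → ℚ) → ℚ
Σ[ as ] f = Σℚ (List.map f as)

allVecs : (n t : ℕ) → List (Vec (Fin n) t)
allVecs n zero    = [] ∷ []
allVecs n (suc t) = concatMap (λ x → List.map (x ∷_) (allVecs n t)) (allFin n)

-- prefix x_{<i} = (x_1,…,x_{i-1}) (0-based index i : Fin t gives length toℕ i)
prefix : {A : Set} {t : ℕ} (i : Fin t) → Vec A t → Vec A (toℕ i)
prefix zero    _        = []
prefix (suc i) (x ∷ xs) = x ∷ prefix i xs

-- Finite probability spaces: a sample space Ω enumerated (without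
-- repetition) by the list ωs, with probability weights μ : Ω → ℚ.
-- Random variables are functions out of Ω.

module Prob {Ω : Set} (ωs : List Ω) (μ : Ω → ℚ) where

  Pr : {A : Set} → DecidableEquality A → (Ω → A) → A → ℚ
  Pr _≟A_ Z a = Σ[ ωs ] λ ω → if ⌊ Z ω ≟A a ⌋ then μ ω else 0ℚ

  Pr₂ : {A B : Set} → DecidableEquality A → DecidableEquality B →
        (Ω → A) → (Ω → B) → A → B → ℚ
  Pr₂ _≟A_ _≟B_ Z W a b = Pr (≡-decˣ _≟A_ _≟B_) (λ ω → Z ω , W ω) (a , b)

  cp : {A : Set} → List A → DecidableEquality A → (Ω → A) → ℚ
  cp as _≟A_ Z = Σ[ as ] λ a → Pr _≟A_ Z a * Pr _≟A_ Z a

  -- Pr[Z = a | W = b] (only meaningful when Pr[W = b] ≠ 0; set to 0 otherwise)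
  PrCond : {A B : Set} → DecidableEquality A → DecidableEquality B →
           (Ω → A) → (Ω → B) → A → B → ℚ
  PrCond _≟A_ _≟B_ Z W a b with Pr _≟B_ W b ≟ 0ℚ
  ... | yes _  = 0ℚ
  ... | no p≢0 = _÷_ (Pr₂ _≟A_ _≟B_ Z W a b) (Pr _≟B_ W b) {{≢-nonZero p≢0}}

  cpGiven : {A B : Set} → List A → DecidableEquality A → DecidableEquality B →
            (Ω → A) → (Ω → B) → B → ℚ
  cpGiven as _≟A_ _≟B_ Z W b =
    Σ[ as ] λ a → PrCond _≟A_ _≟B_ Z W a b * PrCond _≟A_ _≟B_ Z W a b

  cpCond : {A B : Set} → List A → DecidableEquality A → List B → DecidableEquality B →
           (Ω → A) → (Ω → B) → ℚ
  cpCond as _≟A_ bs _≟B_ Z W =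
    Σ[ bs ] λ b → Pr _≟B_ W b * cpGiven as _≟A_ _≟B_ Z W b

-- Hash families: a multiset of L ≥ 1 functions [N] → [M], given as an
-- indexed family ℋ : Fin L → (Fin N → Fin M) (so |ℋ| = L); H is the
-- uniformly random index in Fin L.

uniformH : (L : ℕ) .{{_ : ℕ.NonZero L}} → Fin L → ℚ
uniformH L _ = + 1 / L

collisionPr : {N M L : ℕ} .{{_ : ℕ.NonZero L}} → (Fin L → Fin N → Fin M) →
              Fin N → Fin N → ℚ
collisionPr {L = L} ℋ x₁ x₂ =
  Prob.Pr (allFin L) (uniformH L) _≟ᵇ_ (λ h → ⌊ ℋ h x₁ ≟ᶠ ℋ h x₂ ⌋) true

IsTwoUniversal : {N M L : ℕ} .{{_ : ℕ.NonZero L}} .{{_ : ℕ.NonZero M}} →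
                 (Fin L → Fin N → Fin M) → Set
IsTwoUniversal {N} {M} ℋ =
  (x₁ x₂ : Fin N) → ¬ (x₁ ≡ x₂) → collisionPr ℋ x₁ x₂ ≤ + 1 / M

IsDistribution : (N T : ℕ) → (Vec (Fin N) T → ℚ) → Set
IsDistribution N T p = ((x : Vec (Fin N) T) → 0ℚ ≤ p x) × (Σ[ allVecs N T ] p ≡ 1ℚ)

IsBlockSource : (N T : ℕ) → (Vec (Fin N) T → ℚ) → (oneOverK : ℚ) → Set
IsBlockSource N T p oneOverK =
  (i : Fin T) (xs : Vec (Fin N) (toℕ i)) →
  0ℚ < Pr (≡-decᵛ _≟ᶠ_) (prefix i) xs →
  cpGiven (allFin N) _≟ᶠ_ (≡-decᵛ _≟ᶠ_) (λ x → lookup x i) (prefix i) xs ≤ oneOverK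
  where open Prob (allVecs N T) p

-- Joint space of (H, X) with H uniform on Fin L and independent of X:
-- Pr[H = h, X = x] = (1/L) · p(x).

JointΩ : (L N T : ℕ) → Set
JointΩ L N T = Fin L × Vec (Fin N) T

jointOutcomes : (L N T : ℕ) → List (JointΩ L N T)
jointOutcomes L N T = cartesianProduct (allFin L) (allVecs N T)

jointμ : {L N T : ℕ} .{{_ : ℕ.NonZero L}} → (Vec (Fin N) T → ℚ) → JointΩ L N T → ℚ
jointμ {L} p (h , x) = uniformH L h * p x

Hrv : {L N T : ℕ} → JointΩ L N T → Fin L
Hrv (h , x) = h

Yrv : {L N M T : ℕ} → (Fin L → Fin N → Fin M) → Fin T → JointΩ L N T → Fin M
Yrv ℋ i (h , x) = ℋ h (lookup x i)

HYprefix : {L N M T : ℕ} → (Fin L → Fin N → Fin M) → (i : Fin T) →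
           JointΩ L N T → Fin L × Vec (Fin M) (toℕ i)
HYprefix ℋ i (h , x) = h , Vec.map (ℋ h) (prefix i x)

{-# OPTIONS --safe #-}
module Submission where

-- Since H is uniform and independent of X, Pr[H = h] = 1/|ℋ|, whence cp(H) = 1/|ℋ|.
-- For the second claim write cp(Z | W) = Σ_{b,a} Pr[Z = a, W = b]² / Pr[W = b].  The map
-- (q, r) ↦ q²/r is subadditive on 0 ≤ q ≤ r (Cauchy–Schwarz), so conditioning on the finer
-- variable (H, X_{<i}) instead of (H, Y_{<i}) can only increase the collision probability.
-- Given X_{<i} = x, let q_v = Pr[X_i = v, X_{<i} = x]; averaging over h,
-- Σ_a (Σ_{h v = a} q_v)² = Σ_{v,w} q_v q_w Pr_h[h v = h w] ≤ Σ_v q_v² + (Σ_v q_v)²/M by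
-- 2-universality.  Divided by Pr[X_{<i} = x] this is at most Pr[X_{<i} = x] (1/K + 1/M) by the
-- block-source condition, and summing over x gives 1/M + 1/K.

open import Defs
open import Data.Bool using (Bool; true; false; if_then_else_; _∧_) renaming (_≟_ to _≟ᵇ_)
open import Data.Fin using (Fin; toℕ; zero; suc)
open import Data.Fin.Properties using (suc-injective) renaming (_≟_ to _≟ᶠ_)
open import Data.Integer using (+_)
import Data.Integer as ℤ
import Data.Integer.Properties as ℤ
open import Data.List as List using (List; []; _∷_; _++_; allFin; cartesianProduct; concatMap)
open import Data.List.Properties using (map-tabulate)
open import Data.Nat using (ℕ; NonZero; zero; suc)
import Data.Nat.Coprimality as Coprime
open import Data.Product using (_×_; _,_)
open import Data.Product.Properties using () renaming (≡-dec to ≡-decˣ)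
open import Data.Rational
  using (ℚ; mkℚ; 0ℚ; 1ℚ; Positive; NonNegative; _/_; 1/_; _+_; _*_; _÷_; _-_; _≤_; _<_; _≟_; ≢-nonZero; positive; nonNegative; nonPositive)
open import Data.Rational.Properties
open import Data.Rational.Solver using (module +-*-Solver)
open import Data.Sum using (inj₁; inj₂)
open import Data.Unit using (tt)
open import Data.Vec as Vec using (Vec; []; _∷_; lookup)
open import Data.Vec.Properties using () renaming (≡-dec to ≡-decᵛ)
open import Function using (_∘_; id)
open import Function.Bundles using (mk⇔)
open import Relation.Binary.Definitions using (DecidableEquality)
open import Relation.Binary.PropositionalEquality using (_≡_; refl; sym; trans; cong; cong₂; module ≡-Reasoning)
open import Relation.Nullary using (Dec; yes; no; ¬_; _×-dec_; contradiction)
open import Relation.Nullary.Decidable using (⌊_⌋; isYes≗does; dec-true; dec-false; does-⇔)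
open +-*-Solver using (solve; _:+_; _:*_; _:-_; _:=_)

[_]·_ : Bool → ℚ → ℚ
[ b ]· c = if b then c else 0ℚ

infixr 6.5 [_]·_

[]·-∧ : ∀ x y c → [ x ∧ y ]· c ≡ [ x ]· [ y ]· c
[]·-∧ true  y c = refl
[]·-∧ false y c = refl

[]·-*ˡ : ∀ x a c → a * ([ x ]· c) ≡ [ x ]· a * c
[]·-*ˡ true  a c = refl
[]·-*ˡ false a c = *-zeroʳ a

[]·-*ʳ : ∀ x a c → ([ x ]· c) * a ≡ [ x ]· c * a
[]·-*ʳ true  a c = refl
[]·-*ʳ false a c = *-zeroˡ a

[]·-nonNeg : ∀ x {c} → 0ℚ ≤ c → 0ℚ ≤ [ x ]· c
[]·-nonNeg true  0≤c = 0≤c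
[]·-nonNeg false 0≤c = ≤-refl

[]·-mono-≤ : ∀ x {c e} → c ≤ e → [ x ]· c ≤ [ x ]· e
[]·-mono-≤ true  c≤e = c≤e
[]·-mono-≤ false c≤e = ≤-refl

[]·-∧-≤ : ∀ x y {c} → 0ℚ ≤ c → [ x ∧ y ]· c ≤ [ y ]· c
[]·-∧-≤ true  y     0≤c = ≤-refl
[]·-∧-≤ false true  0≤c = 0≤c
[]·-∧-≤ false false 0≤c = ≤-refl

isYes-⇔ : {P Q : Set} (p? : Dec P) (q? : Dec Q) → (P → Q) → (Q → P) → ⌊ p? ⌋ ≡ ⌊ q? ⌋
isYes-⇔ p? q? to from =
  trans (isYes≗does p?) (trans (does-⇔ (mk⇔ to from) p? q?) (sym (isYes≗does q?)))

isYes-true : {P : Set} (p? : Dec P) → P → ⌊ p? ⌋ ≡ true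
isYes-true p? p = trans (isYes≗does p?) (dec-true p? p)

isYes-false : {P : Set} (p? : Dec P) → ¬ P → ⌊ p? ⌋ ≡ false
isYes-false p? ¬p = trans (isYes≗does p?) (dec-false p? ¬p)

isYes-×-dec : {P Q : Set} (p? : Dec P) (q? : Dec Q) → ⌊ p? ×-dec q? ⌋ ≡ ⌊ p? ⌋ ∧ ⌊ q? ⌋
isYes-×-dec (yes _) (yes _) = refl
isYes-×-dec (yes _) (no _)  = refl
isYes-×-dec (no _)  _       = refl

[]·-split : {P Q R : Set} (r? : Dec R) (p? : Dec P) (q? : Dec Q) →
            (R → P × Q) → (P × Q → R) → ∀ c → [ ⌊ r? ⌋ ]· c ≡ [ ⌊ p? ⌋ ]· [ ⌊ q? ⌋ ]· c
[]·-split r? p? q? to from c = begin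
  [ ⌊ r? ⌋ ]· c                ≡⟨ cong ([_]· c) (isYes-⇔ r? (p? ×-dec q?) to from) ⟩
  [ ⌊ p? ×-dec q? ⌋ ]· c       ≡⟨ cong ([_]· c) (isYes-×-dec p? q?) ⟩
  [ ⌊ p? ⌋ ∧ ⌊ q? ⌋ ]· c       ≡⟨ []·-∧ ⌊ p? ⌋ ⌊ q? ⌋ c ⟩
  [ ⌊ p? ⌋ ]· [ ⌊ q? ⌋ ]· c    ∎
  where open ≡-Reasoning

[]·²-⇔ : {P₁ P₂ Q₁ Q₂ : Set} (p₁? : Dec P₁) (p₂? : Dec P₂) (q₁? : Dec Q₁) (q₂? : Dec Q₂) →
         (P₁ × P₂ → Q₁ × Q₂) → (Q₁ × Q₂ → P₁ × P₂) →
         ∀ c → [ ⌊ p₁? ⌋ ]· [ ⌊ p₂? ⌋ ]· c ≡ [ ⌊ q₁? ⌋ ]· [ ⌊ q₂? ⌋ ]· c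
[]·²-⇔ p₁? p₂? q₁? q₂? to from c =
  trans (sym ([]·-split (p₁? ×-dec p₂?) p₁? p₂? id id c))
        ([]·-split (p₁? ×-dec p₂?) q₁? q₂? to from c)

module _ {A : Set} where

  Σ-cong : (xs : List A) {f g : A → ℚ} → (∀ x → f x ≡ g x) → Σ[ xs ] f ≡ Σ[ xs ] g
  Σ-cong []       f≗g = refl
  Σ-cong (x ∷ xs) f≗g = cong₂ _+_ (f≗g x) (Σ-cong xs f≗g)

  Σ-zero : (xs : List A) {f : A → ℚ} → (∀ x → f x ≡ 0ℚ) → Σ[ xs ] f ≡ 0ℚ
  Σ-zero []       f≗0 = refl
  Σ-zero (x ∷ xs) f≗0 = trans (cong₂ _+_ (f≗0 x) (Σ-zero xs f≗0)) (+-identityˡ 0ℚ)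

  Σ-+ : (xs : List A) (f g : A → ℚ) → Σ[ xs ] (λ x → f x + g x) ≡ Σ[ xs ] f + Σ[ xs ] g
  Σ-+ []       f g = refl
  Σ-+ (x ∷ xs) f g = trans (cong (_+_ (f x + g x)) (Σ-+ xs f g))
                           (solve 4 (λ a b c d → (a :+ b) :+ (c :+ d) := (a :+ c) :+ (b :+ d)) refl
                                    (f x) (g x) (Σ[ xs ] f) (Σ[ xs ] g))

  Σ-*ˡ : (xs : List A) (c : ℚ) (f : A → ℚ) → Σ[ xs ] (λ x → c * f x) ≡ c * Σ[ xs ] f
  Σ-*ˡ []       c f = sym (*-zeroʳ c)
  Σ-*ˡ (x ∷ xs) c f = trans (cong (_+_ (c * f x)) (Σ-*ˡ xs c f)) (sym (*-distribˡ-+ c _ _))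

  Σ-*ʳ : (xs : List A) (c : ℚ) (f : A → ℚ) → Σ[ xs ] (λ x → f x * c) ≡ Σ[ xs ] f * c
  Σ-*ʳ xs c f = trans (Σ-cong xs (λ x → *-comm (f x) c)) (trans (Σ-*ˡ xs c f) (*-comm c _))

  Σ-[]· : (xs : List A) (b : Bool) (f : A → ℚ) → Σ[ xs ] (λ x → [ b ]· f x) ≡ [ b ]· Σ[ xs ] f
  Σ-[]· xs true  f = refl
  Σ-[]· xs false f = Σ-zero xs (λ _ → refl)

  Σ-mono-≤ : (xs : List A) {f g : A → ℚ} → (∀ x → f x ≤ g x) → Σ[ xs ] f ≤ Σ[ xs ] g
  Σ-mono-≤ []       f≤g = ≤-refl
  Σ-mono-≤ (x ∷ xs) f≤g = +-mono-≤ (f≤g x) (Σ-mono-≤ xs f≤g)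

  Σ-nonNeg : (xs : List A) {f : A → ℚ} → (∀ x → 0ℚ ≤ f x) → 0ℚ ≤ Σ[ xs ] f
  Σ-nonNeg xs 0≤f = ≤-trans (≤-reflexive (sym (Σ-zero xs (λ _ → refl)))) (Σ-mono-≤ xs 0≤f)

  Σ-++ : (xs ys : List A) (f : A → ℚ) → Σ[ xs ++ ys ] f ≡ Σ[ xs ] f + Σ[ ys ] f
  Σ-++ []       ys f = sym (+-identityˡ _)
  Σ-++ (x ∷ xs) ys f = trans (cong (_+_ (f x)) (Σ-++ xs ys f)) (sym (+-assoc (f x) _ _))

Σ-map : {A B : Set} (g : A → B) (xs : List A) (f : B → ℚ) → Σ[ List.map g xs ] f ≡ Σ[ xs ] (f ∘ g)
Σ-map g []       f = refl
Σ-map g (x ∷ xs) f = cong (_+_ (f (g x))) (Σ-map g xs f)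

module _ {A B : Set} where

  Σ-swap : (xs : List A) (ys : List B) (f : A → B → ℚ) →
           Σ[ xs ] (λ x → Σ[ ys ] (f x)) ≡ Σ[ ys ] (λ y → Σ[ xs ] (λ x → f x y))
  Σ-swap []       ys f = sym (Σ-zero ys (λ _ → refl))
  Σ-swap (x ∷ xs) ys f = trans (cong (_+_ (Σ[ ys ] (f x))) (Σ-swap xs ys f)) (sym (Σ-+ ys (f x) _))

  Σ-concatMap : (g : A → List B) (xs : List A) (f : B → ℚ) →
                Σ[ concatMap g xs ] f ≡ Σ[ xs ] (λ x → Σ[ g x ] f)
  Σ-concatMap g []       f = refl
  Σ-concatMap g (x ∷ xs) f = trans (Σ-++ (g x) (concatMap g xs) f) (cong (_+_ (Σ[ g x ] f)) (Σ-concatMap g xs f))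

  Σ-cartesianProduct : (xs : List A) (ys : List B) (f : A × B → ℚ) →
                       Σ[ cartesianProduct xs ys ] f ≡ Σ[ xs ] (λ x → Σ[ ys ] (λ y → f (x , y)))
  Σ-cartesianProduct []       ys f = refl
  Σ-cartesianProduct (x ∷ xs) ys f =
    trans (Σ-++ (List.map (x ,_) ys) (cartesianProduct xs ys) f)
          (cong₂ _+_ (Σ-map (x ,_) ys f) (Σ-cartesianProduct xs ys f))

Σ-allFin-suc : ∀ n (f : Fin (suc n) → ℚ) → Σ[ allFin (suc n) ] f ≡ f zero + Σ[ allFin n ] (f ∘ suc)
Σ-allFin-suc n f = cong (λ fs → f zero + Σℚ fs) (trans (map-tabulate suc f) (sym (map-tabulate id (f ∘ suc))))

-- The ≡⟨⟩ step unfolds ℚ addition to the normalisation of its numerator over denominator 1.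
Σ-allFin-1 : ∀ n → Σ[ allFin n ] (λ _ → 1ℚ) ≡ mkℚ (+ n) 0 (Coprime.sym (Coprime.1-coprimeTo n))
Σ-allFin-1 zero    = refl
Σ-allFin-1 (suc n) = begin
  Σ[ allFin (suc n) ] (λ _ → 1ℚ)                        ≡⟨ Σ-allFin-suc n (λ _ → 1ℚ) ⟩
  1ℚ + Σ[ allFin n ] (λ _ → 1ℚ)                         ≡⟨ cong (_+_ 1ℚ) (Σ-allFin-1 n) ⟩
  1ℚ + mkℚ (+ n) 0 (Coprime.sym (Coprime.1-coprimeTo n)) ≡⟨⟩
  (+ 1 ℤ.* + 1 ℤ.+ + n ℤ.* + 1) / 1                     ≡⟨ cong (λ z → (+ 1 ℤ.+ z) / 1) (ℤ.*-identityʳ (+ n)) ⟩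
  + suc n / 1                                            ≡⟨ normalize-coprime (Coprime.sym (Coprime.1-coprimeTo (suc n))) ⟩
  mkℚ (+ suc n) 0 (Coprime.sym (Coprime.1-coprimeTo (suc n))) ∎
  where open ≡-Reasoning

Σ-uniform : ∀ L .{{_ : NonZero L}} → Σ[ allFin L ] (λ _ → + 1 / L) ≡ 1ℚ
Σ-uniform (suc l) = begin
  Σ[ allFin (suc l) ] (λ _ → + 1 / suc l)       ≡⟨ Σ-cong (allFin (suc l)) (λ _ → sym (*-identityˡ (+ 1 / suc l))) ⟩
  Σ[ allFin (suc l) ] (λ _ → 1ℚ * (+ 1 / suc l)) ≡⟨ Σ-*ʳ (allFin (suc l)) (+ 1 / suc l) (λ _ → 1ℚ) ⟩
  Σ[ allFin (suc l) ] (λ _ → 1ℚ) * (+ 1 / suc l) ≡⟨ cong₂ _*_ (Σ-allFin-1 (suc l)) (normalize-coprime (Coprime.1-coprimeTo (suc l))) ⟩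
  ℓ * 1/ ℓ                                        ≡⟨ *-inverseʳ ℓ ⟩
  1ℚ                                              ∎
  where
  open ≡-Reasoning
  ℓ : ℚ
  ℓ = mkℚ (+ suc l) 0 (Coprime.sym (Coprime.1-coprimeTo (suc l)))

Σ-*-Σ : {A : Set} (xs : List A) (f g : A → ℚ) → Σ[ xs ] f * Σ[ xs ] g ≡ Σ[ xs ] (λ v → Σ[ xs ] (λ w → f v * g w))
Σ-*-Σ xs f g = trans (sym (Σ-*ʳ xs (Σ[ xs ] g) f)) (Σ-cong xs (λ v → sym (Σ-*ˡ xs (f v) g)))

-- bs lists every element of B exactly once.
IsEnumeration : {B : Set} → List B → Set
IsEnumeration {B} bs =
  (_≟B_ : DecidableEquality B) (w : B) (g : B → ℚ) → Σ[ bs ] (λ b → [ ⌊ w ≟B b ⌋ ]· g b) ≡ g w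

allFin-isEnumeration : ∀ n → IsEnumeration (allFin n)
allFin-isEnumeration (suc n) _≟B_ zero g = begin
  Σ[ allFin (suc n) ] (λ b → [ ⌊ zero ≟B b ⌋ ]· g b)    ≡⟨ Σ-allFin-suc n (λ b → [ ⌊ zero ≟B b ⌋ ]· g b) ⟩
  [ ⌊ zero ≟B zero ⌋ ]· g zero + Σ[ allFin n ] (λ j → [ ⌊ zero ≟B suc j ⌋ ]· g (suc j))
    ≡⟨ cong₂ _+_ (cong ([_]· g zero) (isYes-true (zero ≟B zero) refl))
                 (Σ-zero (allFin n) (λ j → cong ([_]· g (suc j)) (isYes-false (zero ≟B suc j) λ ())) ) ⟩
  g zero + 0ℚ                                                           ≡⟨ +-identityʳ (g zero) ⟩
  g zero                                                                ∎
  where open ≡-Reasoning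
allFin-isEnumeration (suc n) _≟B_ (suc w) g = begin
  Σ[ allFin (suc n) ] (λ b → [ ⌊ suc w ≟B b ⌋ ]· g b)   ≡⟨ Σ-allFin-suc n (λ b → [ ⌊ suc w ≟B b ⌋ ]· g b) ⟩
  [ ⌊ suc w ≟B zero ⌋ ]· g zero + Σ[ allFin n ] (λ j → [ ⌊ suc w ≟B suc j ⌋ ]· g (suc j))
    ≡⟨ cong₂ _+_ (cong ([_]· g zero) (isYes-false (suc w ≟B zero) λ ()))
                 (Σ-cong (allFin n) λ j →
                    cong ([_]· g (suc j)) (isYes-⇔ (suc w ≟B suc j) (w ≟ᶠ j) suc-injective (cong suc))) ⟩
  0ℚ + Σ[ allFin n ] (λ j → [ ⌊ w ≟ᶠ j ⌋ ]· g (suc j))                ≡⟨ +-identityˡ _ ⟩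
  Σ[ allFin n ] (λ j → [ ⌊ w ≟ᶠ j ⌋ ]· g (suc j))                     ≡⟨ allFin-isEnumeration n _≟ᶠ_ w (g ∘ suc) ⟩
  g (suc w)                                                             ∎
  where open ≡-Reasoning

allVecs-isEnumeration : ∀ n t → IsEnumeration (allVecs n t)
allVecs-isEnumeration n zero _≟B_ [] g =
  trans (cong (λ b → [ b ]· g [] + 0ℚ) (isYes-true ([] ≟B []) refl)) (+-identityʳ (g []))
allVecs-isEnumeration n (suc t) _≟B_ (x ∷ ws) g = begin
  Σ[ concatMap (λ y → List.map (y ∷_) (allVecs n t)) (allFin n) ] (λ b → [ ⌊ (x ∷ ws) ≟B b ⌋ ]· g b)
    ≡⟨ Σ-concatMap _ (allFin n) _ ⟩
  Σ[ allFin n ] (λ y → Σ[ List.map (y ∷_) (allVecs n t) ] (λ b → [ ⌊ (x ∷ ws) ≟B b ⌋ ]· g b))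
    ≡⟨ Σ-cong (allFin n) (λ y → trans (Σ-map (y ∷_) (allVecs n t) _) (Σ-cong (allVecs n t) λ v →
         []·-split ((x ∷ ws) ≟B (y ∷ v)) (x ≟ᶠ y) (≡-decᵛ _≟ᶠ_ ws v)
                   (λ { refl → refl , refl }) (λ { (refl , refl) → refl }) (g (y ∷ v)))) ⟩
  Σ[ allFin n ] (λ y → Σ[ allVecs n t ] (λ v → [ ⌊ x ≟ᶠ y ⌋ ]· [ ⌊ ≡-decᵛ _≟ᶠ_ ws v ⌋ ]· g (y ∷ v)))
    ≡⟨ Σ-cong (allFin n) (λ y → trans (Σ-[]· (allVecs n t) ⌊ x ≟ᶠ y ⌋ _)
         (cong ([ ⌊ x ≟ᶠ y ⌋ ]·_) (allVecs-isEnumeration n t (≡-decᵛ _≟ᶠ_) ws (g ∘ (y ∷_))))) ⟩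
  Σ[ allFin n ] (λ y → [ ⌊ x ≟ᶠ y ⌋ ]· g (y ∷ ws))
    ≡⟨ allFin-isEnumeration n _≟ᶠ_ x (λ y → g (y ∷ ws)) ⟩
  g (x ∷ ws) ∎
  where open ≡-Reasoning

cartesianProduct-isEnumeration : {A B : Set} (as : List A) (bs : List B) →
  IsEnumeration as → IsEnumeration bs → IsEnumeration (cartesianProduct as bs)
cartesianProduct-isEnumeration {A} {B} as bs as-enum bs-enum _≟_ (a₀ , b₀) g = begin
  Σ[ cartesianProduct as bs ] (λ ab → [ ⌊ (a₀ , b₀) ≟ ab ⌋ ]· g ab)
    ≡⟨ Σ-cartesianProduct as bs _ ⟩
  Σ[ as ] (λ a → Σ[ bs ] (λ b → [ ⌊ (a₀ , b₀) ≟ (a , b) ⌋ ]· g (a , b)))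
    ≡⟨ Σ-cong as (λ a → Σ-cong bs λ b →
         []·-split ((a₀ , b₀) ≟ (a , b)) (a₀ ≟A a) (b₀ ≟B b)
                   (λ { refl → refl , refl }) (λ { (refl , refl) → refl }) (g (a , b))) ⟩
  Σ[ as ] (λ a → Σ[ bs ] (λ b → [ ⌊ a₀ ≟A a ⌋ ]· [ ⌊ b₀ ≟B b ⌋ ]· g (a , b)))
    ≡⟨ Σ-cong as (λ a → trans (Σ-[]· bs ⌊ a₀ ≟A a ⌋ _)
         (cong ([ ⌊ a₀ ≟A a ⌋ ]·_) (bs-enum _≟B_ b₀ (λ b → g (a , b))))) ⟩
  Σ[ as ] (λ a → [ ⌊ a₀ ≟A a ⌋ ]· g (a , b₀))
    ≡⟨ as-enum _≟A_ a₀ (λ a → g (a , b₀)) ⟩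
  g (a₀ , b₀) ∎
  where
  open ≡-Reasoning
  _≟A_ : DecidableEquality A
  a ≟A a′ with (a , b₀) ≟ (a′ , b₀)
  ... | yes refl = yes refl
  ... | no ≢     = no λ { refl → ≢ refl }
  _≟B_ : DecidableEquality B
  b ≟B b′ with (a₀ , b) ≟ (a₀ , b′)
  ... | yes refl = yes refl
  ... | no ≢     = no λ { refl → ≢ refl }

Σ-partition : {Ω C : Set} (ωs : List Ω) (cs : List C) → IsEnumeration cs →
              (_≟C_ : DecidableEquality C) (V : Ω → C) (g : Ω → ℚ) →
              Σ[ ωs ] g ≡ Σ[ cs ] (λ c → Σ[ ωs ] (λ ω → [ ⌊ V ω ≟C c ⌋ ]· g ω))
Σ-partition ωs cs cs-enum _≟C_ V g =
  sym (trans (Σ-swap cs ωs _) (Σ-cong ωs (λ ω → cs-enum _≟C_ (V ω) (λ _ → g ω))))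

*-cancelʳ-≡ : ∀ {p q r} → ¬ r ≡ 0ℚ → p * r ≡ q * r → p ≡ q
*-cancelʳ-≡ {p} {q} {r} r≢0 pr≡qr = begin
  p                ≡⟨ sym (*-identityʳ p) ⟩
  p * 1ℚ           ≡⟨ cong (p *_) (sym (*-inverseʳ r {{≢-nonZero r≢0}})) ⟩
  p * (r * 1/r)    ≡⟨ sym (*-assoc p r 1/r) ⟩
  p * r * 1/r      ≡⟨ cong (_* 1/r) pr≡qr ⟩
  q * r * 1/r      ≡⟨ *-assoc q r 1/r ⟩
  q * (r * 1/r)    ≡⟨ cong (q *_) (*-inverseʳ r {{≢-nonZero r≢0}}) ⟩
  q * 1ℚ           ≡⟨ *-identityʳ q ⟩
  q                ∎
  where
  open ≡-Reasoning
  1/r : ℚ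
  1/r = 1/_ r {{≢-nonZero r≢0}}

p≤p+q : ∀ p {q} → 0ℚ ≤ q → p ≤ p + q
p≤p+q p 0≤q = ≤-trans (≤-reflexive (sym (+-identityʳ p))) (+-monoʳ-≤ p 0≤q)

square-nonNeg : ∀ z → 0ℚ ≤ z * z
square-nonNeg z with ≤-total 0ℚ z
... | inj₁ 0≤z = nonNegative⁻¹ _ {{nonNeg*nonNeg⇒nonNeg z {{nonNegative 0≤z}} z {{nonNegative 0≤z}}}}
... | inj₂ z≤0 = nonNegative⁻¹ _ {{nonPos*nonPos⇒nonPos z {{nonPositive z≤0}} z {{nonPositive z≤0}}}}

-- q² / r, set to 0 at r = 0 like PrCond, so that Pr[W = b] · PrCond² = sqOver Pr₂ Pr in all cases.
sqOver : ℚ → ℚ → ℚ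
sqOver q r with r ≟ 0ℚ
... | yes _   = 0ℚ
... | no r≢0 = _÷_ (q * q) r {{≢-nonZero r≢0}}

sqOver-zeroʳ : ∀ q {r} → r ≡ 0ℚ → sqOver q r ≡ 0ℚ
sqOver-zeroʳ q {r} r≡0 with r ≟ 0ℚ
... | yes _   = refl
... | no r≢0 = contradiction r≡0 r≢0

sqOver-nonZero : ∀ q {r} (r≢0 : ¬ r ≡ 0ℚ) → sqOver q r ≡ q * q * (1/_ r {{≢-nonZero r≢0}})
sqOver-nonZero q {r} r≢0 with r ≟ 0ℚ
... | yes r≡0 = contradiction r≡0 r≢0
... | no _    = refl

sqOver-*-cancel : ∀ q {r} → ¬ r ≡ 0ℚ → sqOver q r * r ≡ q * q
sqOver-*-cancel q {r} r≢0 = begin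
  sqOver q r * r                             ≡⟨ cong (_* r) (sqOver-nonZero q r≢0) ⟩
  q * q * (1/_ r {{≢-nonZero r≢0}}) * r      ≡⟨ *-assoc (q * q) _ r ⟩
  q * q * (1/_ r {{≢-nonZero r≢0}} * r)      ≡⟨ cong (q * q *_) (*-inverseˡ r {{≢-nonZero r≢0}}) ⟩
  q * q * 1ℚ                                 ≡⟨ *-identityʳ (q * q) ⟩
  q * q                                      ∎
  where open ≡-Reasoning

Σ-sqOver-*-cancel : {J : Set} (js : List J) (q : J → ℚ) {r : ℚ} → ¬ r ≡ 0ℚ →
                    Σ[ js ] (λ j → sqOver (q j) r) * r ≡ Σ[ js ] (λ j → q j * q j)
Σ-sqOver-*-cancel js q {r} r≢0 =
  trans (sym (Σ-*ʳ js r (λ j → sqOver (q j) r))) (Σ-cong js (λ j → sqOver-*-cancel (q j) r≢0))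

-- Cauchy–Schwarz for two terms: after clearing denominators the gap is (q₁ r₂ − q₂ r₁)².
sqOver-+-≤-pos : ∀ {q₁ r₁ q₂ r₂} → 0ℚ < r₁ → 0ℚ < r₂ →
                 sqOver (q₁ + q₂) (r₁ + r₂) ≤ sqOver q₁ r₁ + sqOver q₂ r₂
sqOver-+-≤-pos {q₁} {r₁} {q₂} {r₂} 0<r₁ 0<r₂ = *-cancelʳ-≤-pos t {{t-pos}} (begin
  sqOver (q₁ + q₂) s * t
    ≡⟨ regroup (sqOver (q₁ + q₂) s) ⟩
  sqOver (q₁ + q₂) s * s * (r₁ * r₂)
    ≡⟨ cong (_* (r₁ * r₂)) (sqOver-*-cancel (q₁ + q₂) (≢0 s-pos)) ⟩
  (q₁ + q₂) * (q₁ + q₂) * (r₁ * r₂)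
    ≤⟨ p≤p+q _ (square-nonNeg (q₁ * r₂ - q₂ * r₁)) ⟩
  (q₁ + q₂) * (q₁ + q₂) * (r₁ * r₂) + (q₁ * r₂ - q₂ * r₁) * (q₁ * r₂ - q₂ * r₁)
    ≡⟨ solve 4 (λ q₁ q₂ r₁ r₂ →
         (q₁ :+ q₂) :* (q₁ :+ q₂) :* (r₁ :* r₂) :+ (q₁ :* r₂ :- q₂ :* r₁) :* (q₁ :* r₂ :- q₂ :* r₁)
         := q₁ :* q₁ :* (r₂ :* (r₁ :+ r₂)) :+ q₂ :* q₂ :* (r₁ :* (r₁ :+ r₂))) refl q₁ q₂ r₁ r₂ ⟩
  q₁ * q₁ * (r₂ * s) + q₂ * q₂ * (r₁ * s)
    ≡⟨ sym (cong₂ (λ a b → a * (r₂ * s) + b * (r₁ * s))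
                  (sqOver-*-cancel q₁ (≢0 0<r₁)) (sqOver-*-cancel q₂ (≢0 0<r₂))) ⟩
  sqOver q₁ r₁ * r₁ * (r₂ * s) + sqOver q₂ r₂ * r₂ * (r₁ * s)
    ≡⟨ solve 5 (λ a b r₁ r₂ s → a :* r₁ :* (r₂ :* s) :+ b :* r₂ :* (r₁ :* s)
                                := (a :+ b) :* (r₁ :* r₂ :* s)) refl (sqOver q₁ r₁) (sqOver q₂ r₂) r₁ r₂ s ⟩
  (sqOver q₁ r₁ + sqOver q₂ r₂) * t ∎)
  where
  open ≤-Reasoning
  s : ℚ
  s = r₁ + r₂
  t : ℚ
  t = r₁ * r₂ * s
  s-pos : 0ℚ < s
  s-pos = positive⁻¹ s {{pos+pos⇒pos r₁ {{positive 0<r₁}} r₂ {{positive 0<r₂}}}}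
  t-pos : Positive t
  t-pos = pos*pos⇒pos (r₁ * r₂) {{pos*pos⇒pos r₁ {{positive 0<r₁}} r₂ {{positive 0<r₂}}}} s {{positive s-pos}}
  ≢0 : ∀ {r} → 0ℚ < r → ¬ r ≡ 0ℚ
  ≢0 0<r r≡0 = <-irrefl (sym r≡0) 0<r
  regroup : ∀ a → a * t ≡ a * s * (r₁ * r₂)
  regroup a = solve 4 (λ a r₁ r₂ s → a :* (r₁ :* r₂ :* s) := a :* s :* (r₁ :* r₂)) refl a r₁ r₂ s

sqOver-+-zeroˡ : ∀ {q₁ r₁} q₂ r₂ → q₁ ≡ 0ℚ → r₁ ≡ 0ℚ → sqOver (q₁ + q₂) (r₁ + r₂) ≡ sqOver q₁ r₁ + sqOver q₂ r₂
sqOver-+-zeroˡ q₂ r₂ refl refl =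
  trans (cong₂ sqOver (+-identityˡ q₂) (+-identityˡ r₂)) (sym (+-identityˡ (sqOver q₂ r₂)))

sqOver-+-≤ : ∀ {q₁ r₁ q₂ r₂} → 0ℚ ≤ q₁ → q₁ ≤ r₁ → 0ℚ ≤ q₂ → q₂ ≤ r₂ →
             sqOver (q₁ + q₂) (r₁ + r₂) ≤ sqOver q₁ r₁ + sqOver q₂ r₂
sqOver-+-≤ {q₁} {r₁} {q₂} {r₂} 0≤q₁ q₁≤r₁ 0≤q₂ q₂≤r₂ = by-cases (r₁ ≟ 0ℚ) (r₂ ≟ 0ℚ)
  -- Casing on a Dec argument instead of with: a with on rᵢ ≟ 0ℚ would also abstract the test inside sqOver.
  where
  vanishes : ∀ {q r} → 0ℚ ≤ q → q ≤ r → r ≡ 0ℚ → q ≡ 0ℚ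
  vanishes 0≤q q≤r r≡0 = ≤-antisym (≤-trans q≤r (≤-reflexive r≡0)) 0≤q
  pos : ∀ {q r} → 0ℚ ≤ q → q ≤ r → ¬ r ≡ 0ℚ → 0ℚ < r
  pos {r = r} 0≤q q≤r r≢0 = positive⁻¹ r {{nonNeg∧nonZero⇒pos r {{nonNegative (≤-trans 0≤q q≤r)}} {{≢-nonZero r≢0}}}}
  by-cases : Dec (r₁ ≡ 0ℚ) → Dec (r₂ ≡ 0ℚ) → sqOver (q₁ + q₂) (r₁ + r₂) ≤ sqOver q₁ r₁ + sqOver q₂ r₂
  by-cases (yes r₁≡0) _ = ≤-reflexive (sqOver-+-zeroˡ q₂ r₂ (vanishes 0≤q₁ q₁≤r₁ r₁≡0) r₁≡0)
  by-cases (no _) (yes r₂≡0) = ≤-reflexive (begin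
    sqOver (q₁ + q₂) (r₁ + r₂)    ≡⟨ cong₂ sqOver (+-comm q₁ q₂) (+-comm r₁ r₂) ⟩
    sqOver (q₂ + q₁) (r₂ + r₁)    ≡⟨ sqOver-+-zeroˡ q₁ r₁ (vanishes 0≤q₂ q₂≤r₂ r₂≡0) r₂≡0 ⟩
    sqOver q₂ r₂ + sqOver q₁ r₁   ≡⟨ +-comm (sqOver q₂ r₂) _ ⟩
    sqOver q₁ r₁ + sqOver q₂ r₂   ∎)
    where open ≡-Reasoning
  by-cases (no r₁≢0) (no r₂≢0) = sqOver-+-≤-pos (pos 0≤q₁ q₁≤r₁ r₁≢0) (pos 0≤q₂ q₂≤r₂ r₂≢0)

sqOver-Σ-≤ : {J : Set} (js : List J) (q r : J → ℚ) → (∀ j → 0ℚ ≤ q j) → (∀ j → q j ≤ r j) →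
             sqOver (Σ[ js ] q) (Σ[ js ] r) ≤ Σ[ js ] (λ j → sqOver (q j) (r j))
sqOver-Σ-≤ []       q r 0≤q q≤r = ≤-refl
sqOver-Σ-≤ (j ∷ js) q r 0≤q q≤r =
  ≤-trans (sqOver-+-≤ (0≤q j) (q≤r j) (Σ-nonNeg js 0≤q) (Σ-mono-≤ js q≤r))
          (+-monoʳ-≤ (sqOver (q j) (r j)) (sqOver-Σ-≤ js q r 0≤q q≤r))

sqOver-*-homogeneous : ∀ u q r → ¬ u ≡ 0ℚ → sqOver (u * q) (u * r) ≡ u * sqOver q r
sqOver-*-homogeneous u q r u≢0 = by-cases (r ≟ 0ℚ)
  where
  by-cases : Dec (r ≡ 0ℚ) → sqOver (u * q) (u * r) ≡ u * sqOver q r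
  by-cases (yes r≡0) = trans (sqOver-zeroʳ (u * q) (trans (cong (u *_) r≡0) (*-zeroʳ u)))
                             (sym (trans (cong (u *_) (sqOver-zeroʳ q r≡0)) (*-zeroʳ u)))
  by-cases (no r≢0) = *-cancelʳ-≡ ur≢0 (begin
    sqOver (u * q) (u * r) * (u * r)   ≡⟨ sqOver-*-cancel (u * q) ur≢0 ⟩
    u * q * (u * q)                    ≡⟨ solve 2 (λ u q → u :* q :* (u :* q) := u :* (q :* q) :* u) refl u q ⟩
    u * (q * q) * u                    ≡⟨ cong (λ c → u * c * u) (sym (sqOver-*-cancel q r≢0)) ⟩
    u * (sqOver q r * r) * u           ≡⟨ solve 3 (λ u d r → u :* (d :* r) :* u := u :* d :* (u :* r)) refl u (sqOver q r) r ⟩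
    u * sqOver q r * (u * r)           ∎)
    where
    open ≡-Reasoning
    ur≢0 : ¬ u * r ≡ 0ℚ
    ur≢0 ur≡0 = r≢0 (*-cancelʳ-≡ u≢0 (trans (*-comm r u) (trans ur≡0 (sym (*-zeroˡ u)))))

[]·-sqOver : ∀ x q r → sqOver ([ x ]· q) ([ x ]· r) ≡ [ x ]· sqOver q r
[]·-sqOver true  q r = refl
[]·-sqOver false q r = refl

module FiniteProbability {Ω : Set} (ωs : List Ω) (μ : Ω → ℚ) (μ≥0 : ∀ ω → 0ℚ ≤ μ ω) where

  open Prob ωs μ

  module _ {B : Set} (_≟B_ : DecidableEquality B) where

    Pr-nonNeg : (W : Ω → B) (b : B) → 0ℚ ≤ Pr _≟B_ W b
    Pr-nonNeg W b = Σ-nonNeg ωs (λ ω → []·-nonNeg ⌊ W ω ≟B b ⌋ (μ≥0 ω))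

    Σ-Pr : (bs : List B) → IsEnumeration bs → (W : Ω → B) → Σ[ bs ] (Pr _≟B_ W) ≡ Σ[ ωs ] μ
    Σ-Pr bs bs-enum W = sym (Σ-partition ωs bs bs-enum _≟B_ W μ)

    Σ-Pr₂ : {A : Set} (_≟A_ : DecidableEquality A) (as : List A) → IsEnumeration as →
            (Z : Ω → A) (W : Ω → B) (b : B) → Σ[ as ] (λ a → Pr₂ _≟A_ _≟B_ Z W a b) ≡ Pr _≟B_ W b
    Σ-Pr₂ _≟A_ as as-enum Z W b = begin
      Σ[ as ] (λ a → Pr₂ _≟A_ _≟B_ Z W a b)
        ≡⟨ Σ-swap as ωs _ ⟩
      Σ[ ωs ] (λ ω → Σ[ as ] (λ a → [ ⌊ ≡-decˣ _≟A_ _≟B_ (Z ω , W ω) (a , b) ⌋ ]· μ ω))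
        ≡⟨ Σ-cong ωs (λ ω → Σ-cong as λ a →
             []·-split (≡-decˣ _≟A_ _≟B_ (Z ω , W ω) (a , b)) (Z ω ≟A a) (W ω ≟B b)
                       (λ { refl → refl , refl }) (λ { (refl , refl) → refl }) (μ ω)) ⟩
      Σ[ ωs ] (λ ω → Σ[ as ] (λ a → [ ⌊ Z ω ≟A a ⌋ ]· [ ⌊ W ω ≟B b ⌋ ]· μ ω))
        ≡⟨ Σ-cong ωs (λ ω → as-enum _≟A_ (Z ω) (λ _ → [ ⌊ W ω ≟B b ⌋ ]· μ ω)) ⟩
      Pr _≟B_ W b ∎
      where open ≡-Reasoning

  module _ {A B : Set} (_≟A_ : DecidableEquality A) (_≟B_ : DecidableEquality B) where

    Pr₂≤Pr : (Z : Ω → A) (W : Ω → B) (a : A) (b : B) → Pr₂ _≟A_ _≟B_ Z W a b ≤ Pr _≟B_ W b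
    Pr₂≤Pr Z W a b = Σ-mono-≤ ωs λ ω → begin
      [ ⌊ ≡-decˣ _≟A_ _≟B_ (Z ω , W ω) (a , b) ⌋ ]· μ ω
        ≡⟨ []·-split (≡-decˣ _≟A_ _≟B_ (Z ω , W ω) (a , b)) (Z ω ≟A a) (W ω ≟B b)
                     (λ { refl → refl , refl }) (λ { (refl , refl) → refl }) (μ ω) ⟩
      [ ⌊ Z ω ≟A a ⌋ ]· [ ⌊ W ω ≟B b ⌋ ]· μ ω
        ≡⟨ sym ([]·-∧ ⌊ Z ω ≟A a ⌋ ⌊ W ω ≟B b ⌋ (μ ω)) ⟩
      [ ⌊ Z ω ≟A a ⌋ ∧ ⌊ W ω ≟B b ⌋ ]· μ ω
        ≤⟨ []·-∧-≤ ⌊ Z ω ≟A a ⌋ ⌊ W ω ≟B b ⌋ (μ≥0 ω) ⟩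
      [ ⌊ W ω ≟B b ⌋ ]· μ ω ∎
      where open ≤-Reasoning

    PrCond-zero : (Z : Ω → A) (W : Ω → B) (a : A) (b : B) → Pr _≟B_ W b ≡ 0ℚ → PrCond _≟A_ _≟B_ Z W a b ≡ 0ℚ
    PrCond-zero Z W a b Pr≡0 with Pr _≟B_ W b ≟ 0ℚ
    ... | yes _    = refl
    ... | no Pr≢0 = contradiction Pr≡0 Pr≢0

    PrCond-nonZero : (Z : Ω → A) (W : Ω → B) (a : A) (b : B) (Pr≢0 : ¬ Pr _≟B_ W b ≡ 0ℚ) →
                     PrCond _≟A_ _≟B_ Z W a b ≡ Pr₂ _≟A_ _≟B_ Z W a b * (1/_ (Pr _≟B_ W b) {{≢-nonZero Pr≢0}})
    PrCond-nonZero Z W a b Pr≢0 with Pr _≟B_ W b ≟ 0ℚ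
    ... | yes Pr≡0 = contradiction Pr≡0 Pr≢0
    ... | no _     = refl

    Pr-*-PrCond² : (Z : Ω → A) (W : Ω → B) (a : A) (b : B) →
                   Pr _≟B_ W b * (PrCond _≟A_ _≟B_ Z W a b * PrCond _≟A_ _≟B_ Z W a b)
                   ≡ sqOver (Pr₂ _≟A_ _≟B_ Z W a b) (Pr _≟B_ W b)
    Pr-*-PrCond² Z W a b = by-cases (r ≟ 0ℚ)
      where
      r : ℚ
      r = Pr _≟B_ W b
      q : ℚ
      q = Pr₂ _≟A_ _≟B_ Z W a b
      c : ℚ
      c = PrCond _≟A_ _≟B_ Z W a b
      by-cases : Dec (r ≡ 0ℚ) → r * (c * c) ≡ sqOver q r
      by-cases (yes r≡0) = begin
        r * (c * c)     ≡⟨ cong (λ z → r * (z * z)) (PrCond-zero Z W a b r≡0) ⟩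
        r * (0ℚ * 0ℚ)   ≡⟨ *-zeroʳ r ⟩
        0ℚ              ≡⟨ sym (sqOver-zeroʳ q r≡0) ⟩
        sqOver q r      ∎
        where open ≡-Reasoning
      by-cases (no r≢0) = begin
        r * (c * c)                        ≡⟨ cong (λ z → r * (z * z)) (PrCond-nonZero Z W a b r≢0) ⟩
        r * ((q * 1/r) * (q * 1/r))        ≡⟨ solve 3 (λ r q i → r :* ((q :* i) :* (q :* i)) := q :* q :* i :* (r :* i)) refl r q 1/r ⟩
        q * q * 1/r * (r * 1/r)            ≡⟨ cong (q * q * 1/r *_) (*-inverseʳ r {{≢-nonZero r≢0}}) ⟩
        q * q * 1/r * 1ℚ                   ≡⟨ *-identityʳ _ ⟩
        q * q * 1/r                        ≡⟨ sym (sqOver-nonZero q r≢0) ⟩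
        sqOver q r                         ∎
        where
        open ≡-Reasoning
        1/r : ℚ
        1/r = 1/_ r {{≢-nonZero r≢0}}

    Pr-*-cpGiven : (as : List A) (Z : Ω → A) (W : Ω → B) (b : B) →
                   Pr _≟B_ W b * cpGiven as _≟A_ _≟B_ Z W b
                   ≡ Σ[ as ] (λ a → sqOver (Pr₂ _≟A_ _≟B_ Z W a b) (Pr _≟B_ W b))
    Pr-*-cpGiven as Z W b = trans (sym (Σ-*ˡ as (Pr _≟B_ W b) _)) (Σ-cong as (λ a → Pr-*-PrCond² Z W a b))

    cpCond≡Σ-sqOver : (as : List A) (bs : List B) (Z : Ω → A) (W : Ω → B) →
                      cpCond as _≟A_ bs _≟B_ Z W
                      ≡ Σ[ bs ] (λ b → Σ[ as ] (λ a → sqOver (Pr₂ _≟A_ _≟B_ Z W a b) (Pr _≟B_ W b)))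
    cpCond≡Σ-sqOver as bs Z W = Σ-cong bs (Pr-*-cpGiven as Z W)

  module _ {B B′ : Set} (_≟B_ : DecidableEquality B) (_≟B′_ : DecidableEquality B′)
           (bs′ : List B′) (bs′-enum : IsEnumeration bs′) (f : B′ → B) where

    Pr-map : (W : Ω → B′) (b : B) →
             Pr _≟B_ (f ∘ W) b ≡ Σ[ bs′ ] (λ b′ → [ ⌊ f b′ ≟B b ⌋ ]· Pr _≟B′_ W b′)
    Pr-map W b = begin
      Pr _≟B_ (f ∘ W) b
        ≡⟨ Σ-partition ωs bs′ bs′-enum _≟B′_ W _ ⟩
      Σ[ bs′ ] (λ b′ → Σ[ ωs ] (λ ω → [ ⌊ W ω ≟B′ b′ ⌋ ]· [ ⌊ f (W ω) ≟B b ⌋ ]· μ ω))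
        ≡⟨ Σ-cong bs′ (λ b′ → trans (Σ-cong ωs λ ω →
             []·²-⇔ (W ω ≟B′ b′) (f (W ω) ≟B b) (f b′ ≟B b) (W ω ≟B′ b′)
                    (λ { (refl , e) → e , refl }) (λ { (e , refl) → refl , e }) (μ ω))
             (Σ-[]· ωs ⌊ f b′ ≟B b ⌋ _)) ⟩
      Σ[ bs′ ] (λ b′ → [ ⌊ f b′ ≟B b ⌋ ]· Pr _≟B′_ W b′) ∎
      where open ≡-Reasoning

    module _ {A : Set} (_≟A_ : DecidableEquality A) where

      Pr₂-mapʳ : (Z : Ω → A) (W : Ω → B′) (a : A) (b : B) →
                 Pr₂ _≟A_ _≟B_ Z (f ∘ W) a b ≡ Σ[ bs′ ] (λ b′ → [ ⌊ f b′ ≟B b ⌋ ]· Pr₂ _≟A_ _≟B′_ Z W a b′)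
      Pr₂-mapʳ Z W a b = begin
        Pr₂ _≟A_ _≟B_ Z (f ∘ W) a b
          ≡⟨ Σ-partition ωs bs′ bs′-enum _≟B′_ W _ ⟩
        Σ[ bs′ ] (λ b′ → Σ[ ωs ] (λ ω → [ ⌊ W ω ≟B′ b′ ⌋ ]· [ ⌊ ≡-decˣ _≟A_ _≟B_ (Z ω , f (W ω)) (a , b) ⌋ ]· μ ω))
          ≡⟨ Σ-cong bs′ (λ b′ → trans (Σ-cong ωs λ ω →
               []·²-⇔ (W ω ≟B′ b′) (≡-decˣ _≟A_ _≟B_ (Z ω , f (W ω)) (a , b))
                      (f b′ ≟B b) (≡-decˣ _≟A_ _≟B′_ (Z ω , W ω) (a , b′))
                      (λ { (refl , refl) → refl , refl }) (λ { (refl , refl) → refl , refl }) (μ ω))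
               (Σ-[]· ωs ⌊ f b′ ≟B b ⌋ _)) ⟩
        Σ[ bs′ ] (λ b′ → [ ⌊ f b′ ≟B b ⌋ ]· Pr₂ _≟A_ _≟B′_ Z W a b′) ∎
        where open ≡-Reasoning

      cpCond-≤-refine : (as : List A) (bs : List B) → IsEnumeration bs → (Z : Ω → A) (W : Ω → B′) →
                        cpCond as _≟A_ bs _≟B_ Z (f ∘ W) ≤ cpCond as _≟A_ bs′ _≟B′_ Z W
      cpCond-≤-refine as bs bs-enum Z W = begin
        cpCond as _≟A_ bs _≟B_ Z (f ∘ W)
          ≡⟨ cpCond≡Σ-sqOver _≟A_ _≟B_ as bs Z (f ∘ W) ⟩
        Σ[ bs ] (λ b → Σ[ as ] (λ a → sqOver (Pr₂ _≟A_ _≟B_ Z (f ∘ W) a b) (Pr _≟B_ (f ∘ W) b)))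
          ≡⟨ Σ-cong bs (λ b → Σ-cong as λ a → cong₂ sqOver (Pr₂-mapʳ Z W a b) (Pr-map W b)) ⟩
        Σ[ bs ] (λ b → Σ[ as ] (λ a → sqOver (Σ[ bs′ ] (λ b′ → [ ⌊ f b′ ≟B b ⌋ ]· q a b′))
                                              (Σ[ bs′ ] (λ b′ → [ ⌊ f b′ ≟B b ⌋ ]· r b′))))
          ≤⟨ Σ-mono-≤ bs (λ b → Σ-mono-≤ as λ a →
               sqOver-Σ-≤ bs′ _ _ (λ b′ → []·-nonNeg ⌊ f b′ ≟B b ⌋ (Pr-nonNeg (≡-decˣ _≟A_ _≟B′_) _ _))
                                  (λ b′ → []·-mono-≤ ⌊ f b′ ≟B b ⌋ (Pr₂≤Pr _≟A_ _≟B′_ Z W a b′))) ⟩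
        Σ[ bs ] (λ b → Σ[ as ] (λ a → Σ[ bs′ ] (λ b′ →
          sqOver ([ ⌊ f b′ ≟B b ⌋ ]· q a b′) ([ ⌊ f b′ ≟B b ⌋ ]· r b′))))
          ≡⟨ Σ-cong bs (λ b → Σ-cong as λ a → Σ-cong bs′ λ b′ → []·-sqOver ⌊ f b′ ≟B b ⌋ _ _) ⟩
        Σ[ bs ] (λ b → Σ[ as ] (λ a → Σ[ bs′ ] (λ b′ → [ ⌊ f b′ ≟B b ⌋ ]· sqOver (q a b′) (r b′))))
          ≡⟨ trans (Σ-swap bs as _) (Σ-cong as λ a → Σ-swap bs bs′ _) ⟩
        Σ[ as ] (λ a → Σ[ bs′ ] (λ b′ → Σ[ bs ] (λ b → [ ⌊ f b′ ≟B b ⌋ ]· sqOver (q a b′) (r b′))))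
          ≡⟨ Σ-cong as (λ a → Σ-cong bs′ λ b′ → bs-enum _≟B_ (f b′) (λ _ → sqOver (q a b′) (r b′))) ⟩
        Σ[ as ] (λ a → Σ[ bs′ ] (λ b′ → sqOver (q a b′) (r b′)))
          ≡⟨ Σ-swap as bs′ _ ⟩
        Σ[ bs′ ] (λ b′ → Σ[ as ] (λ a → sqOver (q a b′) (r b′)))
          ≡⟨ sym (cpCond≡Σ-sqOver _≟A_ _≟B′_ as bs′ Z W) ⟩
        cpCond as _≟A_ bs′ _≟B′_ Z W ∎
        where
        open ≤-Reasoning
        q : A → B′ → ℚ
        q = Pr₂ _≟A_ _≟B′_ Z W
        r : B′ → ℚ
        r = Pr _≟B′_ W

  module _ {A A′ B : Set} (_≟A_ : DecidableEquality A) (_≟A′_ : DecidableEquality A′) (_≟B_ : DecidableEquality B)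
           (as′ : List A′) (as′-enum : IsEnumeration as′) (g : A′ → A) where

    Pr₂-mapˡ : (Z : Ω → A′) (W : Ω → B) (a : A) (b : B) →
               Pr₂ _≟A_ _≟B_ (g ∘ Z) W a b ≡ Σ[ as′ ] (λ a′ → [ ⌊ g a′ ≟A a ⌋ ]· Pr₂ _≟A′_ _≟B_ Z W a′ b)
    Pr₂-mapˡ Z W a b = begin
      Pr₂ _≟A_ _≟B_ (g ∘ Z) W a b
        ≡⟨ Σ-partition ωs as′ as′-enum _≟A′_ Z _ ⟩
      Σ[ as′ ] (λ a′ → Σ[ ωs ] (λ ω → [ ⌊ Z ω ≟A′ a′ ⌋ ]· [ ⌊ ≡-decˣ _≟A_ _≟B_ (g (Z ω) , W ω) (a , b) ⌋ ]· μ ω))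
        ≡⟨ Σ-cong as′ (λ a′ → trans (Σ-cong ωs λ ω →
             []·²-⇔ (Z ω ≟A′ a′) (≡-decˣ _≟A_ _≟B_ (g (Z ω) , W ω) (a , b))
                    (g a′ ≟A a) (≡-decˣ _≟A′_ _≟B_ (Z ω , W ω) (a′ , b))
                    (λ { (refl , refl) → refl , refl }) (λ { (refl , refl) → refl , refl }) (μ ω))
             (Σ-[]· ωs ⌊ g a′ ≟A a ⌋ _)) ⟩
      Σ[ as′ ] (λ a′ → [ ⌊ g a′ ≟A a ⌋ ]· Pr₂ _≟A′_ _≟B_ Z W a′ b) ∎
      where open ≡-Reasoning


fibreSum : {N M : ℕ} → (Fin N → Fin M) → (Fin N → ℚ) → Fin M → ℚ
fibreSum {N} f q a = Σ[ allFin N ] (λ v → [ ⌊ f v ≟ᶠ a ⌋ ]· q v)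

Σ-fibreSum² : {N M : ℕ} (f : Fin N → Fin M) (q : Fin N → ℚ) →
              Σ[ allFin M ] (λ a → fibreSum f q a * fibreSum f q a)
              ≡ Σ[ allFin N ] (λ v → Σ[ allFin N ] (λ w → [ ⌊ f w ≟ᶠ f v ⌋ ]· q v * q w))
Σ-fibreSum² {N} {M} f q = begin
  Σ[ allFin M ] (λ a → fibreSum f q a * fibreSum f q a)
    ≡⟨ Σ-cong (allFin M) (λ a → Σ-*-Σ (allFin N) (onFibre a) (onFibre a)) ⟩
  Σ[ allFin M ] (λ a → Σ[ allFin N ] (λ v → Σ[ allFin N ] (λ w → onFibre a v * onFibre a w)))
    ≡⟨ trans (Σ-swap (allFin M) (allFin N) _) (Σ-cong (allFin N) λ v → Σ-swap (allFin M) (allFin N) _) ⟩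
  Σ[ allFin N ] (λ v → Σ[ allFin N ] (λ w → Σ[ allFin M ] (λ a → onFibre a v * onFibre a w)))
    ≡⟨ Σ-cong (allFin N) (λ v → Σ-cong (allFin N) λ w → begin
         Σ[ allFin M ] (λ a → onFibre a v * onFibre a w)
           ≡⟨ Σ-cong (allFin M) (λ a → []·-*ʳ ⌊ f v ≟ᶠ a ⌋ (onFibre a w) (q v)) ⟩
         Σ[ allFin M ] (λ a → [ ⌊ f v ≟ᶠ a ⌋ ]· q v * onFibre a w)
           ≡⟨ allFin-isEnumeration M _≟ᶠ_ (f v) (λ a → q v * onFibre a w) ⟩
         q v * ([ ⌊ f w ≟ᶠ f v ⌋ ]· q w)
           ≡⟨ []·-*ˡ ⌊ f w ≟ᶠ f v ⌋ (q v) (q w) ⟩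
         [ ⌊ f w ≟ᶠ f v ⌋ ]· q v * q w ∎) ⟩
  Σ[ allFin N ] (λ v → Σ[ allFin N ] (λ w → [ ⌊ f w ≟ᶠ f v ⌋ ]· q v * q w)) ∎
  where
  open ≡-Reasoning
  onFibre : Fin M → Fin N → ℚ
  onFibre a v = [ ⌊ f v ≟ᶠ a ⌋ ]· q v

module _ {N M L : ℕ} .{{_ : NonZero M}} .{{_ : NonZero L}} (ℋ : Fin L → Fin N → Fin M) where

  collisionPr-self : ∀ v → collisionPr ℋ v v ≡ 1ℚ
  collisionPr-self v = trans
    (Σ-cong (allFin L) (λ h → cong (λ c → [ ⌊ c ≟ᵇ true ⌋ ]· + 1 / L) (isYes-true (ℋ h v ≟ᶠ ℋ h v) refl)))
    (Σ-uniform L)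

  collisionPr-≤ : IsTwoUniversal ℋ → ∀ v w → collisionPr ℋ w v ≤ [ ⌊ v ≟ᶠ w ⌋ ]· 1ℚ + + 1 / M
  collisionPr-≤ universal v w with v ≟ᶠ w
  ... | yes refl = ≤-trans (≤-reflexive (collisionPr-self v)) (p≤p+q 1ℚ (nonNegative⁻¹ (+ 1 / M) {{normalize-nonNeg 1 M}}))
  ... | no v≢w  = ≤-trans (universal w v (v≢w ∘ sym)) (≤-reflexive (sym (+-identityˡ (+ 1 / M))))

  Σ-hashed-squares : (q : Fin N → ℚ) →
    Σ[ allFin L ] (λ h → + 1 / L * Σ[ allFin M ] (λ a → fibreSum (ℋ h) q a * fibreSum (ℋ h) q a))
    ≡ Σ[ allFin N ] (λ v → Σ[ allFin N ] (λ w → q v * q w * collisionPr ℋ w v))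
  Σ-hashed-squares q = begin
    Σ[ allFin L ] (λ h → u * Σ[ allFin M ] (λ a → fibreSum (ℋ h) q a * fibreSum (ℋ h) q a))
      ≡⟨ Σ-cong (allFin L) (λ h → cong (u *_) (Σ-fibreSum² (ℋ h) q)) ⟩
    Σ[ allFin L ] (λ h → u * Σ[ allFin N ] (λ v → Σ[ allFin N ] (λ w → [ collides h v w ]· q v * q w)))
      ≡⟨ Σ-cong (allFin L) (λ h → trans (sym (Σ-*ˡ (allFin N) u _)) (Σ-cong (allFin N) λ v → sym (Σ-*ˡ (allFin N) u _))) ⟩
    Σ[ allFin L ] (λ h → Σ[ allFin N ] (λ v → Σ[ allFin N ] (λ w → u * ([ collides h v w ]· q v * q w))))
      ≡⟨ trans (Σ-swap (allFin L) (allFin N) _) (Σ-cong (allFin N) λ v → Σ-swap (allFin L) (allFin N) _) ⟩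
    Σ[ allFin N ] (λ v → Σ[ allFin N ] (λ w → Σ[ allFin L ] (λ h → u * ([ collides h v w ]· q v * q w))))
      ≡⟨ Σ-cong (allFin N) (λ v → Σ-cong (allFin N) λ w →
           trans (Σ-cong (allFin L) λ h → swap-weight (collides h v w) (q v * q w))
                 (Σ-*ˡ (allFin L) (q v * q w) _)) ⟩
    Σ[ allFin N ] (λ v → Σ[ allFin N ] (λ w → q v * q w * collisionPr ℋ w v)) ∎
    where
    open ≡-Reasoning
    u : ℚ
    u = + 1 / L
    collides : Fin L → Fin N → Fin N → Bool
    collides h v w = ⌊ ℋ h w ≟ᶠ ℋ h v ⌋
    swap-weight : ∀ c x → u * ([ c ]· x) ≡ x * ([ ⌊ c ≟ᵇ true ⌋ ]· u)
    swap-weight true  x = *-comm u x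
    swap-weight false x = trans (*-zeroʳ u) (sym (*-zeroʳ x))

  Σ-hashed-squares-≤ : IsTwoUniversal ℋ → (q : Fin N → ℚ) → (∀ v → 0ℚ ≤ q v) →
    Σ[ allFin L ] (λ h → + 1 / L * Σ[ allFin M ] (λ a → fibreSum (ℋ h) q a * fibreSum (ℋ h) q a))
    ≤ Σ[ allFin N ] (λ v → q v * q v) + + 1 / M * (Σ[ allFin N ] q * Σ[ allFin N ] q)
  Σ-hashed-squares-≤ universal q 0≤q = begin
    Σ[ allFin L ] (λ h → + 1 / L * Σ[ allFin M ] (λ a → fibreSum (ℋ h) q a * fibreSum (ℋ h) q a))
      ≡⟨ Σ-hashed-squares q ⟩
    Σ[ vs ] (λ v → Σ[ vs ] (λ w → q v * q w * collisionPr ℋ w v))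
      ≤⟨ Σ-mono-≤ vs (λ v → Σ-mono-≤ vs λ w →
           *-monoˡ-≤-nonNeg (q v * q w) {{nonNegative (qq-nonNeg v w)}} (collisionPr-≤ universal v w)) ⟩
    Σ[ vs ] (λ v → Σ[ vs ] (λ w → q v * q w * ([ ⌊ v ≟ᶠ w ⌋ ]· 1ℚ + m)))
      ≡⟨ Σ-cong vs (λ v → trans (Σ-cong vs λ w → distribute v w) (Σ-+ vs _ _)) ⟩
    Σ[ vs ] (λ v → Σ[ vs ] (λ w → [ ⌊ v ≟ᶠ w ⌋ ]· q v * q w) + Σ[ vs ] (λ w → m * (q v * q w)))
      ≡⟨ Σ-cong vs (λ v → cong₂ _+_ (allFin-isEnumeration N _≟ᶠ_ v (λ w → q v * q w)) (Σ-*ˡ vs m _)) ⟩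
    Σ[ vs ] (λ v → q v * q v + m * Σ[ vs ] (λ w → q v * q w))
      ≡⟨ trans (Σ-+ vs _ _) (cong (_+_ (Σ[ vs ] (λ v → q v * q v))) (Σ-*ˡ vs m _)) ⟩
    Σ[ vs ] (λ v → q v * q v) + m * Σ[ vs ] (λ v → Σ[ vs ] (λ w → q v * q w))
      ≡⟨ cong (λ z → Σ[ vs ] (λ v → q v * q v) + m * z) (sym (Σ-*-Σ vs q q)) ⟩
    Σ[ vs ] (λ v → q v * q v) + m * (Σ[ vs ] q * Σ[ vs ] q) ∎
    where
    open ≤-Reasoning
    vs : List (Fin N)
    vs = allFin N
    m : ℚ
    m = + 1 / M
    qq-nonNeg : ∀ v w → 0ℚ ≤ q v * q w
    qq-nonNeg v w = nonNegative⁻¹ _ {{nonNeg*nonNeg⇒nonNeg (q v) {{nonNegative (0≤q v)}} (q w) {{nonNegative (0≤q w)}}}}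
    distribute : ∀ v w → q v * q w * ([ ⌊ v ≟ᶠ w ⌋ ]· 1ℚ + m) ≡ [ ⌊ v ≟ᶠ w ⌋ ]· q v * q w + m * (q v * q w)
    distribute v w = begin-equality
      q v * q w * ([ ⌊ v ≟ᶠ w ⌋ ]· 1ℚ + m)                       ≡⟨ *-distribˡ-+ (q v * q w) _ m ⟩
      q v * q w * ([ ⌊ v ≟ᶠ w ⌋ ]· 1ℚ) + q v * q w * m           ≡⟨ cong₂ _+_ ([]·-*ˡ ⌊ v ≟ᶠ w ⌋ (q v * q w) 1ℚ) (*-comm _ m) ⟩
      [ ⌊ v ≟ᶠ w ⌋ ]· q v * q w * 1ℚ + m * (q v * q w)           ≡⟨ cong (λ z → [ ⌊ v ≟ᶠ w ⌋ ]· z + m * (q v * q w)) (*-identityʳ _) ⟩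
      [ ⌊ v ≟ᶠ w ⌋ ]· q v * q w + m * (q v * q w)                ∎

module HashedSource {N M T L : ℕ} .{{_ : NonZero M}} .{{_ : NonZero L}}
  (ℋ : Fin L → Fin N → Fin M) (p : Vec (Fin N) T → ℚ) (p≥0 : ∀ x → 0ℚ ≤ p x) (Σp≡1 : Σ[ allVecs N T ] p ≡ 1ℚ) where

  u : ℚ
  u = + 1 / L

  u≢0 : ¬ u ≡ 0ℚ
  u≢0 u≡0 = <-irrefl (sym u≡0) (positive⁻¹ u {{normalize-pos 1 L}})

  jointμ≥0 : ∀ ω → 0ℚ ≤ jointμ p ω
  jointμ≥0 (h , x) = nonNegative⁻¹ _ {{nonNeg*nonNeg⇒nonNeg u {{normalize-nonNeg 1 L}} (p x) {{nonNegative (p≥0 x)}}}}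

  xs : List (Vec (Fin N) T)
  xs = allVecs N T
  hs : List (Fin L)
  hs = allFin L

  open Prob (jointOutcomes L N T) (jointμ p)
  open FiniteProbability (jointOutcomes L N T) (jointμ p) jointμ≥0
  module X where
    open Prob xs p public
    open FiniteProbability xs p p≥0 public

  Pr-fixing-H : {C : Set} (_≟C_ : DecidableEquality C) (V : JointΩ L N T → C) (c : C) (h : Fin L)
                {E : Vec (Fin N) T → Set} (E? : (x : Vec (Fin N) T) → Dec (E x)) →
                (∀ h′ x → V (h′ , x) ≡ c → h ≡ h′ × E x) → (∀ h′ x → h ≡ h′ × E x → V (h′ , x) ≡ c) →
                Pr _≟C_ V c ≡ u * Σ[ xs ] (λ x → [ ⌊ E? x ⌋ ]· p x)
  Pr-fixing-H _≟C_ V c h E? to from = begin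
    Pr _≟C_ V c
      ≡⟨ Σ-cartesianProduct hs xs _ ⟩
    Σ[ hs ] (λ h′ → Σ[ xs ] (λ x → [ ⌊ V (h′ , x) ≟C c ⌋ ]· u * p x))
      ≡⟨ Σ-cong hs (λ h′ → Σ-cong xs λ x →
           []·-split (V (h′ , x) ≟C c) (h ≟ᶠ h′) (E? x) (to h′ x) (from h′ x) (u * p x)) ⟩
    Σ[ hs ] (λ h′ → Σ[ xs ] (λ x → [ ⌊ h ≟ᶠ h′ ⌋ ]· [ ⌊ E? x ⌋ ]· u * p x))
      ≡⟨ Σ-cong hs (λ h′ → Σ-[]· xs ⌊ h ≟ᶠ h′ ⌋ _) ⟩
    Σ[ hs ] (λ h′ → [ ⌊ h ≟ᶠ h′ ⌋ ]· Σ[ xs ] (λ x → [ ⌊ E? x ⌋ ]· u * p x))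
      ≡⟨ allFin-isEnumeration L _≟ᶠ_ h _ ⟩
    Σ[ xs ] (λ x → [ ⌊ E? x ⌋ ]· u * p x)
      ≡⟨ trans (Σ-cong xs λ x → sym ([]·-*ˡ ⌊ E? x ⌋ u (p x))) (Σ-*ˡ xs u _) ⟩
    u * Σ[ xs ] (λ x → [ ⌊ E? x ⌋ ]· p x) ∎
    where open ≡-Reasoning

  Pr-H : ∀ h → Pr _≟ᶠ_ Hrv h ≡ u
  Pr-H h = begin
    Pr _≟ᶠ_ Hrv h
      ≡⟨ Pr-fixing-H _≟ᶠ_ Hrv h h (λ _ → yes tt) (λ { _ _ refl → refl , tt }) (λ { _ _ (refl , _) → refl }) ⟩
    u * Σ[ xs ] p  ≡⟨ cong (u *_) Σp≡1 ⟩
    u * 1ℚ         ≡⟨ *-identityʳ u ⟩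
    u              ∎
    where open ≡-Reasoning

  cp-H : cp hs _≟ᶠ_ Hrv ≡ u
  cp-H = begin
    cp hs _≟ᶠ_ Hrv        ≡⟨ Σ-cong hs (λ h → cong₂ _*_ (Pr-H h) (Pr-H h)) ⟩
    Σ[ hs ] (λ _ → u * u) ≡⟨ Σ-*ˡ hs u (λ _ → u) ⟩
    u * Σ[ hs ] (λ _ → u) ≡⟨ cong (u *_) (Σ-uniform L) ⟩
    u * 1ℚ                ≡⟨ *-identityʳ u ⟩
    u                     ∎
    where open ≡-Reasoning

  _≟V_ : ∀ {n t} → DecidableEquality (Vec (Fin n) t)
  _≟V_ = ≡-decᵛ _≟ᶠ_

  module _ (i : Fin T) where

    _≟HX_ : DecidableEquality (Fin L × Vec (Fin N) (toℕ i))
    _≟HX_ = ≡-decˣ _≟ᶠ_ _≟V_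

    Xᵢ : Vec (Fin N) T → Fin N
    Xᵢ x = lookup x i

    HXprefix : JointΩ L N T → Fin L × Vec (Fin N) (toℕ i)
    HXprefix (h , x) = h , prefix i x

    hashPrefix : Fin L × Vec (Fin N) (toℕ i) → Fin L × Vec (Fin M) (toℕ i)
    hashPrefix (h , xp) = h , Vec.map (ℋ h) xp

    P : Vec (Fin N) (toℕ i) → ℚ
    P = X.Pr _≟V_ (prefix i)

    Q : Vec (Fin N) (toℕ i) → Fin N → ℚ
    Q xp v = X.Pr₂ _≟ᶠ_ _≟V_ Xᵢ (prefix i) v xp

    Pr-HXprefix : ∀ h xp → Pr _≟HX_ HXprefix (h , xp) ≡ u * P xp
    Pr-HXprefix h xp = Pr-fixing-H _≟HX_ HXprefix (h , xp) h (λ x → prefix i x ≟V xp)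
                             (λ { _ _ refl → refl , refl }) (λ { _ _ (refl , refl) → refl })

    Pr₂-Y-HXprefix : ∀ a h xp → Pr₂ _≟ᶠ_ _≟HX_ (Yrv ℋ i) HXprefix a (h , xp) ≡ u * fibreSum (ℋ h) (Q xp) a
    Pr₂-Y-HXprefix a h xp = begin
      Pr₂ _≟ᶠ_ _≟HX_ (Yrv ℋ i) HXprefix a (h , xp)
        ≡⟨ Pr-fixing-H (≡-decˣ _≟ᶠ_ _≟HX_) (λ ω → Yrv ℋ i ω , HXprefix ω) (a , (h , xp)) h
                       (λ x → ≡-decˣ _≟ᶠ_ _≟V_ (ℋ h (Xᵢ x) , prefix i x) (a , xp))
                       (λ { _ _ refl → refl , refl }) (λ { _ _ (refl , refl) → refl }) ⟩
      u * X.Pr₂ _≟ᶠ_ _≟V_ (ℋ h ∘ Xᵢ) (prefix i) a xp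
        ≡⟨ cong (u *_) (X.Pr₂-mapˡ _≟ᶠ_ _≟ᶠ_ _≟V_ (allFin N) (allFin-isEnumeration N) (ℋ h) Xᵢ (prefix i) a xp) ⟩
      u * fibreSum (ℋ h) (Q xp) a ∎
      where open ≡-Reasoning

    module _ (universal : IsTwoUniversal ℋ) (k : ℚ)
             (block : ∀ xp → 0ℚ < P xp → X.cpGiven (allFin N) _≟ᶠ_ _≟V_ Xᵢ (prefix i) xp ≤ k) where

      m : ℚ
      m = + 1 / M

      Σ-hashed-sqOver-≤ : ∀ xp →
        Σ[ hs ] (λ h → u * Σ[ allFin M ] (λ a → sqOver (fibreSum (ℋ h) (Q xp) a) (P xp))) ≤ P xp * (m + k)
      Σ-hashed-sqOver-≤ xp = by-cases (r ≟ 0ℚ)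
        where
        r : ℚ
        r = P xp
        lhs : ℚ
        lhs = Σ[ hs ] (λ h → u * Σ[ allFin M ] (λ a → sqOver (fibreSum (ℋ h) (Q xp) a) r))
        by-cases : Dec (r ≡ 0ℚ) → lhs ≤ r * (m + k)
        by-cases (yes r≡0) = ≤-reflexive (trans
          (Σ-zero hs λ h → trans (cong (u *_) (Σ-zero (allFin M) λ a → sqOver-zeroʳ _ r≡0)) (*-zeroʳ u))
          (sym (trans (cong (_* (m + k)) r≡0) (*-zeroˡ (m + k)))))
        by-cases (no r≢0) = *-cancelʳ-≤-pos r {{r-pos}} (begin
          lhs * r
            ≡⟨ trans (sym (Σ-*ʳ hs r _)) (Σ-cong hs λ h →
                 trans (*-assoc u _ r) (cong (u *_) (Σ-sqOver-*-cancel (allFin M) (fibreSum (ℋ h) (Q xp)) r≢0))) ⟩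
          Σ[ hs ] (λ h → u * Σ[ allFin M ] (λ a → fibreSum (ℋ h) (Q xp) a * fibreSum (ℋ h) (Q xp) a))
            ≤⟨ Σ-hashed-squares-≤ ℋ universal (Q xp) (λ v → X.Pr-nonNeg (≡-decˣ _≟ᶠ_ _≟V_) (λ x → Xᵢ x , prefix i x) (v , xp)) ⟩
          Σ[ allFin N ] (λ v → Q xp v * Q xp v) + m * (Σ[ allFin N ] (Q xp) * Σ[ allFin N ] (Q xp))
            ≡⟨ cong₂ (λ s t → s + m * (t * t)) squares (X.Σ-Pr₂ _≟V_ _≟ᶠ_ (allFin N) (allFin-isEnumeration N) Xᵢ (prefix i) xp) ⟩
          r * c * r + m * (r * r)
            ≤⟨ +-monoˡ-≤ (m * (r * r)) (*-monoʳ-≤-nonNeg r {{nonNeg}} (*-monoˡ-≤-nonNeg r {{nonNeg}} (block xp 0<r))) ⟩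
          r * k * r + m * (r * r)
            ≡⟨ solve 3 (λ r k m → r :* k :* r :+ m :* (r :* r) := r :* (m :+ k) :* r) refl r k m ⟩
          r * (m + k) * r ∎)
          where
          open ≤-Reasoning
          c : ℚ
          c = X.cpGiven (allFin N) _≟ᶠ_ _≟V_ Xᵢ (prefix i) xp
          nonNeg : NonNegative r
          nonNeg = nonNegative (X.Pr-nonNeg _≟V_ (prefix i) xp)
          r-pos : Positive r
          r-pos = nonNeg∧nonZero⇒pos r {{nonNeg}} {{≢-nonZero r≢0}}
          0<r : 0ℚ < r
          0<r = positive⁻¹ r {{r-pos}}
          squares : Σ[ allFin N ] (λ v → Q xp v * Q xp v) ≡ r * c * r
          squares = sym (trans (cong (_* r) (X.Pr-*-cpGiven _≟ᶠ_ _≟V_ (allFin N) Xᵢ (prefix i) xp))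
                               (Σ-sqOver-*-cancel (allFin N) (Q xp) r≢0))

      cpCond-Y-≤ : cpCond (allFin M) _≟ᶠ_ (cartesianProduct hs (allVecs M (toℕ i))) (≡-decˣ _≟ᶠ_ _≟V_)
                          (Yrv ℋ i) (HYprefix ℋ i) ≤ m + k
      cpCond-Y-≤ = begin
        cpCond (allFin M) _≟ᶠ_ (cartesianProduct hs (allVecs M (toℕ i))) (≡-decˣ _≟ᶠ_ _≟V_) (Yrv ℋ i) (HYprefix ℋ i)
          ≤⟨ cpCond-≤-refine (≡-decˣ _≟ᶠ_ _≟V_) _≟HX_ hxps
               (cartesianProduct-isEnumeration hs xps (allFin-isEnumeration L) (allVecs-isEnumeration N (toℕ i)))
               hashPrefix _≟ᶠ_ (allFin M) (cartesianProduct hs (allVecs M (toℕ i)))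
               (cartesianProduct-isEnumeration hs (allVecs M (toℕ i)) (allFin-isEnumeration L) (allVecs-isEnumeration M (toℕ i)))
               (Yrv ℋ i) HXprefix ⟩
        cpCond (allFin M) _≟ᶠ_ hxps _≟HX_ (Yrv ℋ i) HXprefix
          ≡⟨ cpCond≡Σ-sqOver _≟ᶠ_ _≟HX_ (allFin M) hxps (Yrv ℋ i) HXprefix ⟩
        Σ[ hxps ] (λ b → Σ[ allFin M ] (λ a → sqOver (Pr₂ _≟ᶠ_ _≟HX_ (Yrv ℋ i) HXprefix a b) (Pr _≟HX_ HXprefix b)))
          ≡⟨ Σ-cartesianProduct hs xps _ ⟩
        Σ[ hs ] (λ h → Σ[ xps ] (λ xp →
          Σ[ allFin M ] (λ a → sqOver (Pr₂ _≟ᶠ_ _≟HX_ (Yrv ℋ i) HXprefix a (h , xp)) (Pr _≟HX_ HXprefix (h , xp)))))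
          ≡⟨ Σ-cong hs (λ h → Σ-cong xps λ xp → trans
               (Σ-cong (allFin M) λ a → trans (cong₂ sqOver (Pr₂-Y-HXprefix a h xp) (Pr-HXprefix h xp))
                                             (sqOver-*-homogeneous u _ _ u≢0))
               (Σ-*ˡ (allFin M) u _)) ⟩
        Σ[ hs ] (λ h → Σ[ xps ] (λ xp → u * Σ[ allFin M ] (λ a → sqOver (fibreSum (ℋ h) (Q xp) a) (P xp))))
          ≡⟨ Σ-swap hs xps _ ⟩
        Σ[ xps ] (λ xp → Σ[ hs ] (λ h → u * Σ[ allFin M ] (λ a → sqOver (fibreSum (ℋ h) (Q xp) a) (P xp))))
          ≤⟨ Σ-mono-≤ xps Σ-hashed-sqOver-≤ ⟩
        Σ[ xps ] (λ xp → P xp * (m + k))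
          ≡⟨ Σ-*ʳ xps (m + k) P ⟩
        Σ[ xps ] P * (m + k)
          ≡⟨ cong (_* (m + k)) (trans (X.Σ-Pr _≟V_ xps (allVecs-isEnumeration N (toℕ i)) (prefix i)) Σp≡1) ⟩
        1ℚ * (m + k)
          ≡⟨ *-identityˡ (m + k) ⟩
        m + k ∎
        where
        open ≤-Reasoning
        xps : List (Vec (Fin N) (toℕ i))
        xps = allVecs N (toℕ i)
        hxps : List (Fin L × Vec (Fin N) (toℕ i))
        hxps = cartesianProduct hs xps

lemma3p3 : (N M T L : ℕ) → .{{_ : NonZero N}} → .{{_ : NonZero M}} → .{{_ : NonZero T}} → .{{_ : NonZero L}} →
    (K : ℚ) → .{{_ : Positive K}} →
    (ℋ : Fin L → Fin N → Fin M) → IsTwoUniversal ℋ →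
    (p : Vec (Fin N) T → ℚ) → IsDistribution N T p →
    IsBlockSource N T p (1/_ K {{pos⇒nonZero K}}) →
    (Prob.cp (jointOutcomes L N T) (jointμ p) (allFin L) _≟ᶠ_ Hrv ≡ + 1 / L)
    × ((i : Fin T) →
       Prob.cpCond (jointOutcomes L N T) (jointμ p)
         (allFin M) _≟ᶠ_
         (cartesianProduct (allFin L) (allVecs M (toℕ i))) (≡-decˣ _≟ᶠ_ (≡-decᵛ _≟ᶠ_))
         (Yrv ℋ i) (HYprefix ℋ i)
       ≤ + 1 / M + 1/_ K {{pos⇒nonZero K}})
lemma3p3 N M T L K ℋ universal p (p≥0 , Σp≡1) block =
  cp-H , λ i → cpCond-Y-≤ i universal (1/_ K {{pos⇒nonZero K}}) (block i)
  where open HashedSource ℋ p p≥0 Σp≡1
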